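{- Let $\rhd$ be a system of ideals for an ordered monoid $G$ and let $x\in G$. Let $\rhd_x$ be the finest system of ideals for $G$ coarser than $\rhd$ such that $0\rhd_x x$. Then for $A\in\mathrm{P}_{\mathrm{fe}}^*(G)$ and $b\in G$: $A\rhd_x b$ if and only if there is an integer $p\ge0$ such that $A,A+x,\dots,A+px\rhd b$.
   Context: Monoids are commutative. An ordered monoid is a commutative monoid $(G,+,0)$ with a partial order $\le_G$ such that $x\le_G y$ implies $x+z\le_G y+z$. $\mathrm{P}_{\mathrm{fe}}^*(G)$ is the set of nonempty finite subsets of $G$; $a$ stands for $\{a\}$, $A,A'$ for $A\cup A'$, $x+A=\{x+a:a\in A\}$, $A+kx$ for $\{a+kx:a\in A\}$. A system of ideals for $G$ is a relation $\rhd$ between $\mathrm{P}_{\mathrm{fe}}^*(G)$ and $G$ such that: $a\rhd a$; $A\rhd b\Rightarrow A,A'\rhd b$; ($A\rhd c$ and $A,c\rhd b$) $\Rightarrow A\rhd b$; $a\le_G b\Rightarrow a\rhd b$; $A\rhd b\Rightarrow y+A\rhd y+b$ for all $y\in G$. $\rhd_2$ is coarser than $\rhd_1$ if $A\rhd_1b$ implies $A\rhd_2b$. -}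

module Defs where

open import Level using (Level; _⊔_; suc)
open import Data.Nat using (ℕ; zero) renaming (suc to 1+)
open import Data.Product using (Σ; _×_; _,_)
open import Data.List.NonEmpty using (List⁺; [_]; _⁺++⁺_; toList) renaming (map to map⁺)
open import Data.List.Membership.Propositional using (_∈_)
open import Function.Bundles using (_⇔_)
open import Relation.Binary.PropositionalEquality using (_≡_)
open import Relation.Binary.Structures using (IsPartialOrder)
open import Algebra.Structures using (IsCommutativeMonoid)

record OrderedMonoid (c ℓ : Level) : Set (Level.suc (c ⊔ ℓ)) where
  infixl 6 _+_
  infix 4 _≤_
  field
    Carrier : Set c
    _+_     : Carrier → Carrier → Carrier
    0#      : Carrier
    _≤_     : Carrier → Carrier → Set ℓ
    isCommutativeMonoid : IsCommutativeMonoid _≡_ _+_ 0#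
    isPartialOrder      : IsPartialOrder _≡_ _≤_
    +-mono-≤ : ∀ {x y} z → x ≤ y → x + z ≤ y + z

module _ {c ℓ : Level} (G : OrderedMonoid c ℓ) where
  open OrderedMonoid G

  -- Nonempty finite subsets of G are represented by nonempty lists;
  -- a relation on them must only depend on the underlying set (see SystemOfIdeals).
  Pfe : Set c
  Pfe = List⁺ Carrier

  SameElems : Pfe → Pfe → Set c
  SameElems A B = ∀ z → (z ∈ toList A) ⇔ (z ∈ toList B)

  Rel▷ : (r : Level) → Set (c ⊔ Level.suc r)
  Rel▷ r = Pfe → Carrier → Set r

  _·_ : ℕ → Carrier → Carrier
  zero · x = 0#
  1+ k · x = (k · x) + x

  _+ₗ_ : Carrier → Pfe → Pfe
  y +ₗ A = map⁺ (y +_) A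

  _+ᵣ_ : Pfe → Carrier → Pfe
  A +ᵣ y = map⁺ (_+ y) A

  shifts : Pfe → Carrier → ℕ → Pfe
  shifts A x zero = A
  shifts A x (1+ p) = shifts A x p ⁺++⁺ (A +ᵣ (1+ p · x))

  record SystemOfIdeals {r : Level} (_▷_ : Rel▷ r) : Set (c ⊔ ℓ ⊔ r) where
    field
      set-invariant : ∀ {A B b} → SameElems A B → A ▷ b → B ▷ b
      refl▷  : ∀ a → [ a ] ▷ a
      weaken : ∀ {A b} A' → A ▷ b → (A ⁺++⁺ A') ▷ b
      cut    : ∀ {A b c'} → A ▷ c' → (A ⁺++⁺ [ c' ]) ▷ b → A ▷ b
      order  : ∀ {a b} → a ≤ b → [ a ] ▷ b
      shift  : ∀ {A b} y → A ▷ b → (y +ₗ A) ▷ (y + b)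

  Coarser : {r s : Level} → Rel▷ s → Rel▷ r → Set (c ⊔ r ⊔ s)
  Coarser ▷₂ ▷₁ = ∀ {A b} → ▷₁ A b → ▷₂ A b

  -- ▷' is the finest system of ideals coarser than ▷ with 0 ▷' x
  -- (finest among systems with relations in the same universe level).
  IsFinestWith : {r : Level} → Rel▷ r → Carrier → Rel▷ r → Set (c ⊔ ℓ ⊔ Level.suc r)
  IsFinestWith {r} ▷ x ▷' =
    SystemOfIdeals ▷' × Coarser ▷' ▷ × ▷' [ 0# ] x ×
    (∀ (▷'' : Rel▷ r) → SystemOfIdeals ▷'' → Coarser ▷'' ▷ → ▷'' [ 0# ] x → Coarser ▷'' ▷')

-- The relation "A, A + x, …, A + p x ▷ b for some p" is itself a system of
-- ideals: the only non-routine axiom is the cut, where a derivation of c from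
-- A + 0x … A + px is shifted by kx to account for each occurrence of c + kx
-- used when deriving b, at the price of enlarging p to p + q. It is coarser
-- than ▷ (take p = 0) and satisfies 0 ▷ x (take p = 1). Conversely, any system
-- ▷' with 0 ▷' x has 0 ▷' kx for all k (cut k times), hence a ▷' a + kx, and
-- then cutting all of A + kx, k ≤ p, into A gives A ▷' b.
module Submission where

open import Defs
open import Level using (Level)
open import Data.Nat using (ℕ)
open import Data.Product using (Σ)
open import Function.Bundles using (_⇔_)

open import Algebra.Structures using (IsCommutativeMonoid)
open import Data.List using ([]; _∷_)
open import Data.List.Membership.Propositional using (_∈_)
open import Data.List.Membership.Propositional.Properties using (∈-++⁺ˡ; ∈-++⁺ʳ; ∈-++⁻; ∈-map⁺; ∈-map⁻)
open import Data.List.NonEmpty using ([_]; _⁺++⁺_; toList)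
open import Data.List.Relation.Unary.Any using (here; there)
open import Data.Nat as ℕ using (zero; z≤n; s≤s) renaming (suc to 1+)
open import Data.Nat.Properties using (m≤n⇒m<n∨m≡n; ≤-trans; n≤1+n; ≤-refl; m≤n+m) renaming (+-mono-≤ to +-mono-≤ℕ)
open import Data.Product using (_×_; _,_)
open import Data.Sum using (_⊎_; inj₁; inj₂; [_,_]′)
open import Function using (id; _∘_)
open import Function.Bundles using (mk⇔; Equivalence)
open import Relation.Binary.PropositionalEquality using (_≡_; refl; sym; trans; cong; subst; module ≡-Reasoning)

module _ {c ℓ : Level} (G : OrderedMonoid c ℓ) where
  open OrderedMonoid G
  open IsCommutativeMonoid isCommutativeMonoid using (assoc; comm; identityˡ; identityʳ)

  infix 4 _⊆_
  _⊆_ : Pfe G → Pfe G → Set c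
  A ⊆ B = ∀ {z} → z ∈ toList A → z ∈ toList B

  infixl 7 _∙_
  _∙_ : ℕ → Carrier → Carrier
  _∙_ = _·_ G

  ∙-homo-+ : ∀ j k x → (j ℕ.+ k) ∙ x ≡ j ∙ x + k ∙ x
  ∙-homo-+ zero k x = sym (identityˡ (k ∙ x))
  ∙-homo-+ (1+ j) k x = begin
    (j ℕ.+ k) ∙ x + x        ≡⟨ cong (_+ x) (∙-homo-+ j k x) ⟩
    (j ∙ x + k ∙ x) + x      ≡⟨ assoc _ _ _ ⟩
    j ∙ x + (k ∙ x + x)      ≡⟨ cong (j ∙ x +_) (comm _ _) ⟩
    j ∙ x + (x + k ∙ x)      ≡⟨ sym (assoc _ _ _) ⟩
    (j ∙ x + x) + k ∙ x      ∎
    where open ≡-Reasoning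

  ∈-shifts⁻ : ∀ {z} A x p → z ∈ toList (shifts G A x p) →
              Σ Carrier λ a → Σ ℕ λ k → a ∈ toList A × k ℕ.≤ p × z ≡ a + k ∙ x
  ∈-shifts⁻ {z} A x zero z∈A = z , 0 , z∈A , z≤n , sym (identityʳ z)
  ∈-shifts⁻ A x (1+ p) z∈ with ∈-++⁻ (toList (shifts G A x p)) z∈
  ... | inj₁ z∈shifts with ∈-shifts⁻ A x p z∈shifts
  ...   | a , k , a∈A , k≤p , z≡ = a , k , a∈A , ≤-trans k≤p (n≤1+n p) , z≡
  ∈-shifts⁻ A x (1+ p) z∈ | inj₂ z∈last with ∈-map⁻ (_+ 1+ p ∙ x) z∈last
  ...   | a , a∈A , z≡ = a , 1+ p , a∈A , ≤-refl , z≡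

  ∈-shifts⁺ : ∀ {a k} A x p → a ∈ toList A → k ℕ.≤ p → a + k ∙ x ∈ toList (shifts G A x p)
  ∈-shifts⁺ {a} A x zero a∈A z≤n = subst (_∈ toList A) (sym (identityʳ a)) a∈A
  ∈-shifts⁺ A x (1+ p) a∈A k≤1+p with m≤n⇒m<n∨m≡n k≤1+p
  ... | inj₁ (s≤s k≤p) = ∈-++⁺ˡ (∈-shifts⁺ A x p a∈A k≤p)
  ... | inj₂ refl      = ∈-++⁺ʳ (toList (shifts G A x p)) (∈-map⁺ (_+ 1+ p ∙ x) a∈A)

  shifts-mono : ∀ {A B} x p → A ⊆ B → shifts G A x p ⊆ shifts G B x p
  shifts-mono {A} {B} x p A⊆B z∈ with ∈-shifts⁻ A x p z∈
  ... | a , k , a∈A , k≤p , refl = ∈-shifts⁺ B x p (A⊆B a∈A) k≤p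

  shifts-mono-≤ : ∀ A x {p q} → p ℕ.≤ q → shifts G A x p ⊆ shifts G A x q
  shifts-mono-≤ A x {p} {q} p≤q z∈ with ∈-shifts⁻ A x p z∈
  ... | a , k , a∈A , k≤p , refl = ∈-shifts⁺ A x q a∈A (≤-trans k≤p p≤q)

  +ₗ-shifts : ∀ y A x p → _+ₗ_ G y (shifts G A x p) ⊆ shifts G (_+ₗ_ G y A) x p
  +ₗ-shifts y A x p z∈ with ∈-map⁻ (y +_) z∈
  ... | w , w∈ , refl with ∈-shifts⁻ A x p w∈
  ...   | a , k , a∈A , k≤p , refl =
    subst (_∈ toList (shifts G (_+ₗ_ G y A) x p)) (assoc y a (k ∙ x))
          (∈-shifts⁺ (_+ₗ_ G y A) x p (∈-map⁺ (y +_) a∈A) k≤p)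

  ∙-shifts : ∀ A x p {k q} → k ℕ.≤ q → _+ₗ_ G (k ∙ x) (shifts G A x p) ⊆ shifts G A x (p ℕ.+ q)
  ∙-shifts A x p {k} {q} k≤q z∈ with ∈-map⁻ (k ∙ x +_) z∈
  ... | w , w∈ , refl with ∈-shifts⁻ A x p w∈
  ...   | a , j , a∈A , j≤p , refl =
    subst (_∈ toList (shifts G A x (p ℕ.+ q))) reassociate
          (∈-shifts⁺ A x (p ℕ.+ q) a∈A (+-mono-≤ℕ j≤p k≤q))
    where
    open ≡-Reasoning
    reassociate : a + (j ℕ.+ k) ∙ x ≡ k ∙ x + (a + j ∙ x)
    reassociate = begin
      a + (j ℕ.+ k) ∙ x      ≡⟨ cong (a +_) (∙-homo-+ j k x) ⟩
      a + (j ∙ x + k ∙ x)    ≡⟨ sym (assoc _ _ _) ⟩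
      (a + j ∙ x) + k ∙ x    ≡⟨ comm _ _ ⟩
      k ∙ x + (a + j ∙ x)    ∎

  module _ {r : Level} {_▷_ : Rel▷ G r} (S : SystemOfIdeals G _▷_) where
    open SystemOfIdeals S

    ▷-mono : ∀ {A B b} → A ⊆ B → A ▷ b → B ▷ b
    ▷-mono {A} {B} A⊆B A▷b = set-invariant same (weaken B A▷b)
      where
      same : SameElems G (A ⁺++⁺ B) B
      same z = mk⇔ ([ A⊆B , id ]′ ∘ ∈-++⁻ (toList A)) (∈-++⁺ʳ (toList A))

    ∈⇒▷ : ∀ {A z} → z ∈ toList A → A ▷ z
    ∈⇒▷ {z = z} z∈A = ▷-mono (λ { (here refl) → z∈A ; (there ()) }) (refl▷ z)

    ▷-cut-list : ∀ Cs {A B b} → (∀ {c} → c ∈ Cs → A ▷ c) →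
                 (∀ {z} → z ∈ toList B → z ∈ toList A ⊎ z ∈ Cs) → B ▷ b → A ▷ b
    ▷-cut-list [] A▷Cs B⊆ B▷b = ▷-mono ([ id , (λ ()) ]′ ∘ B⊆) B▷b
    ▷-cut-list (c ∷ Cs) {A} {B} A▷Cs B⊆ B▷b =
      cut (A▷Cs (here refl))
          (▷-cut-list Cs (λ c′∈Cs → weaken [ c ] (A▷Cs (there c′∈Cs))) B⊆A,c B▷b)
      where
      B⊆A,c : ∀ {z} → z ∈ toList B → z ∈ toList (A ⁺++⁺ [ c ]) ⊎ z ∈ Cs
      B⊆A,c z∈B with B⊆ z∈B
      ... | inj₁ z∈A          = inj₁ (∈-++⁺ˡ z∈A)
      ... | inj₂ (here refl)  = inj₁ (∈-++⁺ʳ (toList A) (here refl))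
      ... | inj₂ (there z∈Cs) = inj₂ z∈Cs

    ▷-cut-all : ∀ {A B b} → (∀ {c} → c ∈ toList B → A ▷ c) → B ▷ b → A ▷ b
    ▷-cut-all {B = B} A▷B = ▷-cut-list (toList B) A▷B inj₂

    0▷multiple : ∀ {x} → [ 0# ] ▷ x → ∀ k → [ 0# ] ▷ (k ∙ x)
    0▷multiple 0▷x zero   = refl▷ 0#
    0▷multiple {x} 0▷x (1+ k) =
      cut (0▷multiple 0▷x k)
          (▷-mono (λ { (here refl) → there (here (identityʳ (k ∙ x))) ; (there ()) })
                  (shift (k ∙ x) 0▷x))

    ▷-+multiple : ∀ {x A a} → [ 0# ] ▷ x → a ∈ toList A → ∀ k → A ▷ (a + k ∙ x)
    ▷-+multiple {A = A} {a} 0▷x a∈A k =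
      ▷-mono (λ { (here refl) → subst (_∈ toList A) (sym (identityʳ a)) a∈A ; (there ()) })
             (shift a (0▷multiple 0▷x k))

  Shifted : ∀ {r} → Rel▷ G r → Carrier → Rel▷ G r
  Shifted _▷_ x A b = Σ ℕ λ p → shifts G A x p ▷ b

  module _ {r : Level} {_▷_ : Rel▷ G r} (S : SystemOfIdeals G _▷_) (x : Carrier) where
    open SystemOfIdeals S

    Shifted-cut : ∀ {A b c} → Shifted _▷_ x A c → Shifted _▷_ x (A ⁺++⁺ [ c ]) b → Shifted _▷_ x A b
    Shifted-cut {A} {b} {c} (p , A▷c) (q , A,c▷b) = p ℕ.+ q , ▷-cut-all S derivable A,c▷b
      where
      derivable : ∀ {z} → z ∈ toList (shifts G (A ⁺++⁺ [ c ]) x q) → shifts G A x (p ℕ.+ q) ▷ z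
      derivable z∈ with ∈-shifts⁻ (A ⁺++⁺ [ c ]) x q z∈
      ... | a , k , a∈A,c , k≤q , refl with ∈-++⁻ (toList A) a∈A,c
      ...   | inj₁ a∈A        = ∈⇒▷ S (shifts-mono-≤ A x (m≤n+m q p) (∈-shifts⁺ A x q a∈A k≤q))
      ...   | inj₂ (here refl) = subst (shifts G A x (p ℕ.+ q) ▷_) (comm (k ∙ x) c)
                                       (▷-mono S (∙-shifts A x p k≤q) (shift (k ∙ x) A▷c))

    Shifted-isSystemOfIdeals : SystemOfIdeals G (Shifted _▷_ x)
    Shifted-isSystemOfIdeals = record
      { set-invariant = λ A≈B (p , h) → p , ▷-mono S (shifts-mono x p (Equivalence.to (A≈B _))) h
      ; refl▷         = λ a → 0 , refl▷ a
      ; weaken        = λ A′ (p , h) → p , ▷-mono S (shifts-mono x p ∈-++⁺ˡ) h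
      ; cut           = Shifted-cut
      ; order         = λ a≤b → 0 , order a≤b
      ; shift         = λ {A} y (p , h) → p , ▷-mono S (+ₗ-shifts y A x p) (shift y h)
      }

    Shifted-0▷x : Shifted _▷_ x [ 0# ] x
    Shifted-0▷x = 1 , subst (shifts G [ 0# ] x 1 ▷_) (trans (identityˡ _) (identityˡ x))
                            (∈⇒▷ S (∈-shifts⁺ [ 0# ] x 1 (here refl) ≤-refl))

  Shifted-finest : ∀ {r s} {_▷_ : Rel▷ G r} {_▷′_ : Rel▷ G s} {x} → SystemOfIdeals G _▷′_ →
                   Coarser G _▷′_ _▷_ → [ 0# ] ▷′ x → Coarser G _▷′_ (Shifted _▷_ x)
  Shifted-finest {_▷′_ = _▷′_} {x} S′ ▷⊆▷′ 0▷′x {A} (p , h) = ▷-cut-all S′ derivable (▷⊆▷′ h)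
    where
    derivable : ∀ {z} → z ∈ toList (shifts G A x p) → A ▷′ z
    derivable z∈ with ∈-shifts⁻ A x p z∈
    ... | a , k , a∈A , _ , refl = ▷-+multiple S′ 0▷′x a∈A k

proposition1p15 : {c ℓ r : Level} (G : OrderedMonoid c ℓ) (▷ : Rel▷ G r) →
    SystemOfIdeals G ▷ → (x : OrderedMonoid.Carrier G) (▷ₓ : Rel▷ G r) →
    IsFinestWith G ▷ x ▷ₓ →
    ∀ (A : Pfe G) (b : OrderedMonoid.Carrier G) →
    ▷ₓ A b ⇔ Σ ℕ (λ p → ▷ (shifts G A x p) b)
proposition1p15 G ▷ S x ▷ₓ (Sₓ , ▷⊆▷ₓ , 0▷ₓx , finest) A b = mk⇔
  (finest (Shifted G ▷ x) (Shifted-isSystemOfIdeals G S x) (λ h → 0 , h) (Shifted-0▷x G S x))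
  (Shifted-finest G Sₓ ▷⊆▷ₓ 0▷ₓx)
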